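{- Let $G_0$ be a connected graph and $e=uv$ an edge of $G_0$. Let $G$ be obtained from $G_0$ by adding four new vertices $p,q,r,s$ and the five new edges $up,pq,qr,rs,sv$. Let $f=pq$, $g=qr$, $h=rs$. Then \begin{enumerate} \item $H_e(G,p,x) = xH_e(G_0,u,x) + 2 + x + 2x^2$, \item $H_e(G,q,x) = x^2H_e(G_0,u,x) + 2 + 2x + x^2$, \item $H_e(G,r,x) = x^2H_e(G_0,v,x) + 2 + 2x + x^2$, \item $H_e(G,s,x) = xH_e(G_0,v,x) + 2 + x + 2x^2$, \item $H_e(G,f,x) = x^2H_e(G_0,u,x) + 1 + 2x + x^2 + x^3$, \item $H_e(G,g,x) = x^2H_e(G_0,e,x) + 1 + 2x + x^2 + x^3$, \item $H_e(G,h,x) = x^2H_e(G_0,v,x) + 1 + 2x + x^2 + x^3$. \end{enumerate}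
   Context: For a connected graph $G$, the distance $d(e,f)$ between edges $e,f$ is their distance as vertices of the line graph $L(G)$; the distance between a vertex $w$ and an edge $e=uv$ is $d(w,e)=\min\{d(w,u),d(w,v)\}$ (usual shortest-path distance). For a vertex $w$, let $d(G,w,k)$ be the number of edges of $G$ at distance $k$ from $w$ (so $d(G,w,0)=\deg(w)$) and $H_e(G,w,x)=\sum_{k\ge0}d(G,w,k)x^k$. For an edge $e$, let $d(G,e,k)$ be the number of edges $f$ of $G$ with $d(e,f)=k$ (so $d(G,e,0)=1$) and $H_e(G,e,x)=\sum_{k\ge0}d(G,e,k)x^k$. -}

module Defs where

open import Data.Nat using (ℕ; zero; suc; _+_; _<ᵇ_; _≡ᵇ_)
open import Data.Bool using (Bool; true; false; _∧_; _∨_; not)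
import Data.Fin as F
open import Data.Fin using (Fin; toℕ; splitAt; _↑ˡ_; _↑ʳ_)
open import Data.Fin.Properties using (_≟_)
open import Data.Sum using (inj₁; inj₂)
open import Data.Product using (_×_; _,_; ∃)
open import Data.Bool.ListAction using (any)
open import Data.List using (List; []; _∷_; length; filterᵇ; map; concatMap; allFin)
open import Relation.Nullary.Decidable using (⌊_⌋)
open import Relation.Binary.PropositionalEquality using (_≡_)

Adj : ℕ → Set
Adj n = Fin n → Fin n → Bool

record IsSimple {n : ℕ} (adj : Adj n) : Set where
  field
    sym     : ∀ a b → adj a b ≡ adj b a
    irrefl  : ∀ a → adj a a ≡ false

_==_ : {n : ℕ} → Fin n → Fin n → Bool
a == b = ⌊ a ≟ b ⌋

within : {V : Set} → (V → V → Bool) → List V → (V → V → Bool) → ℕ → V → V → Bool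
within eq vs adj zero    a b = eq a b
within eq vs adj (suc k) a b =
  within eq vs adj k a b ∨ any (λ c → within eq vs adj k a c ∧ adj c b) vs

-- Given P j = "distance ≤ j", exactly P k = "distance is exactly k".
exactly : (ℕ → Bool) → ℕ → Bool
exactly P zero    = P zero
exactly P (suc k) = P (suc k) ∧ not (P k)

withinV : {n : ℕ} → Adj n → ℕ → Fin n → Fin n → Bool
withinV {n} adj = within _==_ (allFin n) adj

Connected : {n : ℕ} → Adj n → Set
Connected {n} adj = ∀ a b → ∃ λ k → withinV adj k a b ≡ true

-- Edges.  An edge is a pair of vertices; the edge list of G contains each
-- edge once, as (i , j) with i < j.

Edge : ℕ → Set
Edge n = Fin n × Fin n

allPairs : (n : ℕ) → List (Edge n)
allPairs n = concatMap (λ i → map (λ j → (i , j)) (allFin n)) (allFin n)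

edges : {n : ℕ} → Adj n → List (Edge n)
edges {n} adj = filterᵇ (λ { (i , j) → (toℕ i <ᵇ toℕ j) ∧ adj i j }) (allPairs n)

_=E_ : {n : ℕ} → Edge n → Edge n → Bool
(a , b) =E (c , d) = ((a == c) ∧ (b == d)) ∨ ((a == d) ∧ (b == c))

lineAdj : {n : ℕ} → Edge n → Edge n → Bool
lineAdj e@(a , b) f@(c , d) =
  not (e =E f) ∧ ((a == c) ∨ (a == d) ∨ (b == c) ∨ (b == d))

withinE : {n : ℕ} → Adj n → ℕ → Edge n → Edge n → Bool
withinE adj = within _=E_ (edges adj) lineAdj

withinVE : {n : ℕ} → Adj n → ℕ → Fin n → Edge n → Bool
withinVE adj k w (a , b) = withinV adj k w a ∨ withinV adj k w b

Poly : Set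
Poly = ℕ → ℕ

_⊕_ : Poly → Poly → Poly
(P ⊕ Q) k = P k + Q k

-- multiplication by x^m
shift : ℕ → Poly → Poly
shift zero    P k       = P k
shift (suc m) P zero    = 0
shift (suc m) P (suc k) = shift m P k

poly : List ℕ → Poly
poly []       k       = 0
poly (c ∷ cs) zero    = c
poly (c ∷ cs) (suc k) = poly cs k

dV : {n : ℕ} → Adj n → Fin n → ℕ → ℕ
dV adj w k = length (filterᵇ (λ e → exactly (λ j → withinVE adj j w e) k) (edges adj))

HeV : {n : ℕ} → Adj n → Fin n → Poly
HeV = dV

dE : {n : ℕ} → Adj n → Edge n → ℕ → ℕ
dE adj e k = length (filterᵇ (λ f → exactly (λ j → withinE adj j e f) k) (edges adj))

HeE : {n : ℕ} → Adj n → Edge n → Poly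
HeE = dE

-- The construction: G on Fin (n + 4), the old vertex a being a ↑ˡ 4 and
-- the new vertices p, q, r, s being n ↑ʳ F.zero, n ↑ʳ F.suc F.zero, n ↑ʳ F.suc (F.suc F.zero), n ↑ʳ F.suc (F.suc (F.suc F.zero));
-- new edges up, pq, qr, rs, sv.

pathAdj : Fin 4 → Fin 4 → Bool
pathAdj i j = (suc (toℕ i) ≡ᵇ toℕ j) ∨ (suc (toℕ j) ≡ᵇ toℕ i)

crossAdj : {n : ℕ} → Fin n → Fin n → Fin n → Fin 4 → Bool
crossAdj u v a i = ((a == u) ∧ (toℕ i ≡ᵇ 0)) ∨ ((a == v) ∧ (toℕ i ≡ᵇ 3))

extend : {n : ℕ} → Adj n → Fin n → Fin n → Adj (n + 4)
extend {n} adj u v x y with splitAt n x | splitAt n y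
... | inj₁ a | inj₁ b = adj a b
... | inj₁ a | inj₂ j = crossAdj u v a j
... | inj₂ i | inj₁ b = crossAdj u v b i
... | inj₂ i | inj₂ j = pathAdj i j

old : {n : ℕ} → Fin n → Fin (n + 4)
old a = a ↑ˡ 4

vp vq vr vs : {n : ℕ} → Fin (n + 4)
vp {n} = n ↑ʳ F.zero
vq {n} = n ↑ʳ F.suc F.zero
vr {n} = n ↑ʳ F.suc (F.suc F.zero)
vs {n} = n ↑ʳ F.suc (F.suc (F.suc F.zero))

-- A walk from a new vertex x to an old vertex a enters the old graph at u or at v, so d(x, a) is
-- the smaller of viaP x + d(u, a) and viaS x + d(v, a); as u and v are adjacent, one route always
-- wins and d(x, a) = depth x + d(nearest x, a).  In the line graph, d(e, f) = 1 + (the distance from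
-- the nearer endpoint of e to f) for e ≠ f, so the distance from a new edge to an old edge is again
-- an old distance plus a constant; for the middle edge qr it is 3 + d({u, v}, f), which is
-- 2 + d(uv, f) in the line graph of G₀.  Every polynomial of G is therefore a shifted polynomial of
-- G₀ plus the contribution of the five new edges, read off from distances along the path.

module Submission where

open import Defs
open import Data.Bool using (Bool; true; false; _∧_; _∨_; not; if_then_else_; T)
open import Data.Bool.ListAction using (any)
open import Data.Bool.Properties
  using (∨-comm; ∧-comm; ∧-assoc; ∨-zeroʳ; ∧-zeroʳ; ∧-identityʳ; ∨-identityʳ; ∧-distribˡ-∨; T-≡; ⇔→≡)
open import Data.Empty using (⊥; ⊥-elim)
open import Data.Fin using (Fin; toℕ; splitAt; _↑ˡ_; _↑ʳ_)
import Data.Fin as F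
open import Data.Fin.Properties
  using (_≟_; toℕ-injective; toℕ-↑ˡ; toℕ-↑ʳ; toℕ<n; splitAt-↑ˡ; splitAt-↑ʳ;
         splitAt⁻¹-↑ˡ; splitAt⁻¹-↑ʳ; ↑ˡ-injective; ↑ʳ-injective)
open import Data.List using (List; []; _∷_; length; filterᵇ; map; concatMap; allFin; tabulate; _++_)
open import Data.List.Membership.Propositional using (_∈_; lose)
open import Data.List.Membership.Propositional.Properties
  using (∈-allFin; ∈-filter⁺; ∈-filter⁻; ∈-concatMap⁺; ∈-map⁺)
open import Data.List.Relation.Unary.Any using (here; there)
open import Data.Nat using (ℕ; zero; suc; _+_; _≤_; _<_; _⊓_; _<ᵇ_; _≡ᵇ_; ∣_-_∣; z≤n; s≤s)
open import Data.Nat.Properties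
  using (+-0-commutativeMonoid; +-assoc; +-comm; +-suc; +-identityʳ; ≤-refl; ≤-trans; n≤1+n;
         ⊓-glb; ∣n-n∣≡0; ∣-∣-triangle; <-cmp; m≤m+n; <-≤-trans)
open import Algebra.Properties.CommutativeMonoid.Sum +-0-commutativeMonoid
  using (sum; sum-syntax; ∑-distrib-+; sum-cong-≗; sum-replicate-zero)
open import Data.Product using (_×_; _,_; ∃; proj₁; proj₂)
open import Data.Sum using (_⊎_; inj₁; inj₂)
open import Function.Base using (_∘_; case_of_)
open import Function.Bundles using (mk⇔; Equivalence)
open import Relation.Binary.Definitions using (tri<; tri≈; tri>)
open import Relation.Binary.PropositionalEquality
  using (_≡_; _≢_; refl; sym; trans; cong; cong₂; subst; module ≡-Reasoning)
open import Relation.Nullary.Decidable using (yes; no; toWitness)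

∨-trueˡ : ∀ {a} b → a ≡ true → a ∨ b ≡ true
∨-trueˡ b refl = refl

∨-trueʳ : ∀ a {b} → b ≡ true → a ∨ b ≡ true
∨-trueʳ true  _    = refl
∨-trueʳ false refl = refl

∨-true⁻ : ∀ a {b} → a ∨ b ≡ true → a ≡ true ⊎ b ≡ true
∨-true⁻ true  _ = inj₁ refl
∨-true⁻ false p = inj₂ p

∧-true⁻ˡ : ∀ a {b} → a ∧ b ≡ true → a ≡ true
∧-true⁻ˡ true  _ = refl
∧-true⁻ˡ false ()

∧-true⁻ʳ : ∀ a {b} → a ∧ b ≡ true → b ≡ true
∧-true⁻ʳ true  p = p
∧-true⁻ʳ false ()

∧-true : ∀ {a b} → a ≡ true → b ≡ true → a ∧ b ≡ true
∧-true refl refl = refl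

∨-absorbʳ : ∀ {a b} → (b ≡ true → a ≡ true) → a ∨ b ≡ a
∨-absorbʳ {true}          _ = refl
∨-absorbʳ {false} {true}  f = sym (f refl)
∨-absorbʳ {false} {false} _ = refl

∨-absorbˡ : ∀ {a b} → (a ≡ true → b ≡ true) → a ∨ b ≡ b
∨-absorbˡ {true}  f = sym (f refl)
∨-absorbˡ {false} _ = refl

bool-ext : ∀ {a b} → (a ≡ true → b ≡ true) → (b ≡ true → a ≡ true) → a ≡ b
bool-ext to from = ⇔→≡ (mk⇔ to from)

true⊎false : ∀ b → b ≡ true ⊎ b ≡ false
true⊎false true  = inj₁ refl
true⊎false false = inj₂ refl

any-true : ∀ {A : Set} (g : A → Bool) {x} xs → x ∈ xs → g x ≡ true → any g xs ≡ true
any-true g (y ∷ xs) (here refl) p = ∨-trueˡ _ p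
any-true g (y ∷ xs) (there x∈) p = ∨-trueʳ (g y) (any-true g xs x∈ p)

any-true⁻ : ∀ {A : Set} (g : A → Bool) xs → any g xs ≡ true → ∃ λ x → x ∈ xs × g x ≡ true
any-true⁻ g (y ∷ xs) p with ∨-true⁻ (g y) p
... | inj₁ q = y , here refl , q
... | inj₂ q with any-true⁻ g xs q
...   | x , x∈ , r = x , there x∈ , r

module _ {N : ℕ} where

  ==-sound : {a b : Fin N} → (a == b) ≡ true → a ≡ b
  ==-sound {a} {b} p = toWitness {a? = a ≟ b} (Equivalence.from T-≡ p)

  ==-true : {a b : Fin N} → a ≡ b → (a == b) ≡ true
  ==-true {a} {b} a≡b with a ≟ b
  ... | yes _   = refl
  ... | no  a≢b = ⊥-elim (a≢b a≡b)

  ==-false : {a b : Fin N} → a ≢ b → (a == b) ≡ false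
  ==-false {a} {b} a≢b with a ≟ b
  ... | yes a≡b = ⊥-elim (a≢b a≡b)
  ... | no  _   = refl

  ==-refl : (a : Fin N) → (a == a) ≡ true
  ==-refl a = ==-true refl

  ==-sym : (a b : Fin N) → (a == b) ≡ (b == a)
  ==-sym a b = bool-ext (λ p → ==-true (sym (==-sound p))) (λ p → ==-true (sym (==-sound p)))

  suc-== : (a b : Fin N) → (F.suc a == F.suc b) ≡ (a == b)
  suc-== a b with a ≟ b
  ... | yes _ = refl
  ... | no  _ = refl

  infix 4 _∈ₑ_
  _∈ₑ_ : Fin N → Edge N → Set
  z ∈ₑ (x , y) = z ≡ x ⊎ z ≡ y

  ∈ₑ-swap : ∀ {z x y} → z ∈ₑ (x , y) → z ∈ₑ (y , x)
  ∈ₑ-swap (inj₁ e) = inj₂ e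
  ∈ₑ-swap (inj₂ e) = inj₁ e

  =E-∈ₑ : ∀ {c f z} → (c =E f) ≡ true → z ∈ₑ c → z ∈ₑ f
  =E-∈ₑ {c₁ , c₂} {x , y} p z∈ with ∨-true⁻ ((c₁ == x) ∧ (c₂ == y)) p | z∈
  ... | inj₁ q | inj₁ refl = inj₁ (==-sound (∧-true⁻ˡ _ q))
  ... | inj₁ q | inj₂ refl = inj₂ (==-sound (∧-true⁻ʳ (c₁ == x) q))
  ... | inj₂ q | inj₁ refl = inj₂ (==-sound (∧-true⁻ˡ _ q))
  ... | inj₂ q | inj₂ refl = inj₁ (==-sound (∧-true⁻ʳ (c₁ == y) q))

  =E-refl : ∀ (e : Edge N) → (e =E e) ≡ true
  =E-refl (a , b) rewrite ==-refl a | ==-refl b = refl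

  =E-swap : ∀ (a b : Fin N) → ((a , b) =E (b , a)) ≡ true
  =E-swap a b rewrite ==-refl a | ==-refl b = ∨-zeroʳ _

  =E-sym : ∀ (e g : Edge N) → (e =E g) ≡ (g =E e)
  =E-sym (a , b) (x , y) rewrite ==-sym x a | ==-sym y b | ==-sym x b | ==-sym y a =
    cong ((a == x) ∧ (b == y) ∨_) (∧-comm (a == y) (b == x))

  =E-swapˡ : ∀ (a b : Fin N) f → ((b , a) =E f) ≡ ((a , b) =E f)
  =E-swapˡ a b (x , y) =
    trans (∨-comm ((b == x) ∧ (a == y)) _) (cong₂ _∨_ (∧-comm (b == y) (a == x)) (∧-comm (b == x) (a == y)))

  lineAdj-shared : ∀ c f → lineAdj c f ≡ true → ∃ λ z → z ∈ₑ c × z ∈ₑ f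
  lineAdj-shared (c₁ , c₂) (x , y) p with ∨-true⁻ (c₁ == x) (∧-true⁻ʳ (not ((c₁ , c₂) =E (x , y))) p)
  ... | inj₁ r = c₁ , inj₁ refl , inj₁ (==-sound r)
  ... | inj₂ p₂ with ∨-true⁻ (c₁ == y) p₂
  ...   | inj₁ r = c₁ , inj₁ refl , inj₂ (==-sound r)
  ...   | inj₂ p₃ with ∨-true⁻ (c₂ == x) p₃
  ...     | inj₁ r = c₂ , inj₂ refl , inj₁ (==-sound r)
  ...     | inj₂ r = c₂ , inj₂ refl , inj₂ (==-sound r)

  lineAdj-intro : ∀ c f {z} → (c =E f) ≡ false → z ∈ₑ c → z ∈ₑ f → lineAdj c f ≡ true
  lineAdj-intro (c₁ , c₂) (x , y) {z} distinct z∈c z∈f rewrite distinct = shares z∈c z∈f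
    where
    shares : z ∈ₑ (c₁ , c₂) → z ∈ₑ (x , y) → ((c₁ == x) ∨ (c₁ == y) ∨ (c₂ == x) ∨ (c₂ == y)) ≡ true
    shares (inj₁ refl) (inj₁ refl) = ∨-trueˡ _ (==-refl z)
    shares (inj₁ refl) (inj₂ refl) = ∨-trueʳ (c₁ == x) (∨-trueˡ _ (==-refl z))
    shares (inj₂ refl) (inj₁ refl) = ∨-trueʳ (c₁ == x) (∨-trueʳ (c₁ == y) (∨-trueˡ _ (==-refl z)))
    shares (inj₂ refl) (inj₂ refl) = ∨-trueʳ (c₁ == x) (∨-trueʳ (c₁ == y) (∨-trueʳ (c₂ == x) (==-refl z)))

-- Counting

[_] : Bool → ℕ
[ true  ] = 1
[ false ] = 0

[∨] : ∀ a b → (a ≡ true → b ≡ true → ⊥) → [ a ∨ b ] ≡ [ a ] + [ b ]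
[∨] true  true  disjoint = ⊥-elim (disjoint refl refl)
[∨] true  false _        = refl
[∨] false b     _        = refl

count : {A : Set} → (A → Bool) → List A → ℕ
count p xs = length (filterᵇ p xs)

module _ {A : Set} where

  count-∷ : ∀ (p : A → Bool) x xs → count p (x ∷ xs) ≡ [ p x ] + count p xs
  count-∷ p x xs with p x
  ... | true  = refl
  ... | false = refl

  count-cong : ∀ {p q : A → Bool} xs → (∀ x → p x ≡ q x) → count p xs ≡ count q xs
  count-cong         []       _  = refl
  count-cong {p} {q} (x ∷ xs) eq = begin
    count p (x ∷ xs)       ≡⟨ count-∷ p x xs ⟩
    [ p x ] + count p xs   ≡⟨ cong₂ _+_ (cong [_] (eq x)) (count-cong xs eq) ⟩
    [ q x ] + count q xs   ≡⟨ count-∷ q x xs ⟨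
    count q (x ∷ xs)       ∎
    where open ≡-Reasoning

  count-++ : ∀ (p : A → Bool) xs ys → count p (xs ++ ys) ≡ count p xs + count p ys
  count-++ p []       ys = refl
  count-++ p (x ∷ xs) ys = begin
    count p (x ∷ xs ++ ys)              ≡⟨ count-∷ p x (xs ++ ys) ⟩
    [ p x ] + count p (xs ++ ys)        ≡⟨ cong ([ p x ] +_) (count-++ p xs ys) ⟩
    [ p x ] + (count p xs + count p ys) ≡⟨ +-assoc [ p x ] _ _ ⟨
    [ p x ] + count p xs + count p ys   ≡⟨ cong (_+ count p ys) (count-∷ p x xs) ⟨
    count p (x ∷ xs) + count p ys       ∎
    where open ≡-Reasoning

  count-filter : ∀ (r p : A → Bool) xs → count p (filterᵇ r xs) ≡ count (λ x → r x ∧ p x) xs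
  count-filter r p [] = refl
  count-filter r p (x ∷ xs) rewrite count-∷ (λ x → r x ∧ p x) x xs with r x
  ... | true  = trans (count-∷ p x _) (cong ([ p x ] +_) (count-filter r p xs))
  ... | false = count-filter r p xs

  count-split : ∀ (p r : A → Bool) xs →
                count p xs ≡ count (λ x → p x ∧ not (r x)) xs + count (λ x → p x ∧ r x) xs
  count-split p r [] = refl
  count-split p r (x ∷ xs)
    rewrite count-∷ p x xs | count-∷ (λ x → p x ∧ not (r x)) x xs | count-∷ (λ x → p x ∧ r x) x xs
          | count-split p r xs
    with p x | r x
  ... | true  | true  = sym (+-suc _ _)
  ... | true  | false = refl
  ... | false | _     = refl

  count-false : ∀ (xs : List A) → count (λ _ → false) xs ≡ 0
  count-false []       = refl
  count-false (x ∷ xs) = count-false xs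

count-map : ∀ {A C : Set} (p : C → Bool) (g : A → C) xs → count p (map g xs) ≡ count (p ∘ g) xs
count-map p g []       = refl
count-map p g (x ∷ xs) =
  trans (count-∷ p (g x) (map g xs))
        (trans (cong ([ p (g x) ] +_) (count-map p g xs)) (sym (count-∷ (p ∘ g) x xs)))

sum-zero : ∀ {N} (f : Fin N → ℕ) → (∀ i → f i ≡ 0) → sum f ≡ 0
sum-zero {N} f f≗0 = trans (sum-cong-≗ f≗0) (sum-replicate-zero N)

sum-↑ : ∀ m {k} (f : Fin (m + k) → ℕ) → sum f ≡ sum (λ a → f (a ↑ˡ k)) + sum (λ i → f (m ↑ʳ i))
sum-↑ zero    f = refl
sum-↑ (suc m) f = trans (cong (f F.zero +_) (sum-↑ m (f ∘ F.suc))) (sym (+-assoc (f F.zero) _ _))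

<ᵇ-one-way : ∀ m n → m ≢ n → [ m <ᵇ n ] + [ n <ᵇ m ] ≡ 1
<ᵇ-one-way zero    zero    m≢n = ⊥-elim (m≢n refl)
<ᵇ-one-way zero    (suc n) _   = refl
<ᵇ-one-way (suc m) zero    _   = refl
<ᵇ-one-way (suc m) (suc n) m≢n = <ᵇ-one-way m n (m≢n ∘ cong suc)

<⇒<ᵇ≡true : ∀ {m n} → m < n → (m <ᵇ n) ≡ true
<⇒<ᵇ≡true (s≤s z≤n)       = refl
<⇒<ᵇ≡true (s≤s (s≤s m<n)) = <⇒<ᵇ≡true (s≤s m<n)

≤⇒<ᵇ≡false : ∀ {m n} → n ≤ m → (m <ᵇ n) ≡ false
≤⇒<ᵇ≡false z≤n       = refl
≤⇒<ᵇ≡false (s≤s n≤m) = ≤⇒<ᵇ≡false n≤m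

+-<ᵇ : ∀ n a b → (n + a <ᵇ n + b) ≡ (a <ᵇ b)
+-<ᵇ zero    a b = refl
+-<ᵇ (suc n) a b = +-<ᵇ n a b

sum-pick : ∀ {N} (w : Fin N) (h : Fin N → Bool) → ∑[ i < N ] [ (w == i) ∧ h i ] ≡ [ h w ]
sum-pick {suc N} F.zero    h = trans (cong ([ h F.zero ] +_) (sum-zero {N} _ (λ _ → refl))) (+-identityʳ _)
sum-pick {suc N} (F.suc w) h =
  trans (sum-cong-≗ (λ i → cong (λ c → [ c ∧ h (F.suc i) ]) (suc-== w i))) (sum-pick w (h ∘ F.suc))

sum-pickˡ : ∀ {N} (w : Fin N) (h : Fin N → Bool) → ∑[ i < N ] [ (i == w) ∧ h i ] ≡ [ h w ]
sum-pickˡ w h = trans (sum-cong-≗ (λ i → cong (λ c → [ c ∧ h i ]) (==-sym i w))) (sum-pick w h)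

sum-pick₂ : ∀ {N} (w w′ : Fin N) (h : Fin N → Fin N → Bool) →
            ∑[ i < N ] ∑[ j < N ] [ ((w == i) ∧ (w′ == j)) ∧ h i j ] ≡ [ h w w′ ]
sum-pick₂ {N} w w′ h = trans (sum-cong-≗ inner) (sum-pick w (λ i → h i w′))
  where
  inner : ∀ i → ∑[ j < N ] [ ((w == i) ∧ (w′ == j)) ∧ h i j ] ≡ [ (w == i) ∧ h i w′ ]
  inner i = trans (sum-cong-≗ (λ j → cong [_] (reassoc (w == i) (w′ == j) (h i j))))
                  (sum-pick w′ (λ j → (w == i) ∧ h i j))
    where
    reassoc : ∀ x y z → (x ∧ y) ∧ z ≡ y ∧ (x ∧ z)
    reassoc x y z = trans (cong (_∧ z) (∧-comm x y)) (∧-assoc y x z)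

count-tabulate : ∀ {A : Set} N (g : Fin N → A) p → count p (tabulate g) ≡ ∑[ i < N ] [ p (g i) ]
count-tabulate zero    g p = refl
count-tabulate (suc N) g p =
  trans (count-∷ p (g F.zero) _) (cong ([ p (g F.zero) ] +_) (count-tabulate N (g ∘ F.suc) p))

count-concatMap : ∀ {A C : Set} N (g : Fin N → A) (f : A → List C) p →
                  count p (concatMap f (tabulate g)) ≡ ∑[ i < N ] count p (f (g i))
count-concatMap zero    g f p = refl
count-concatMap (suc N) g f p =
  trans (count-++ p (f (g F.zero)) _) (cong (count p (f (g F.zero)) +_) (count-concatMap N (g ∘ F.suc) f p))

count-edges : ∀ {N} (A : Adj N) (p : Edge N → Bool) →
              count p (edges A) ≡ ∑[ i < N ] ∑[ j < N ] [ ((toℕ i <ᵇ toℕ j) ∧ A i j) ∧ p (i , j) ]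
count-edges {N} A p = begin
  count p (edges A)
    ≡⟨ count-filter _ p (allPairs N) ⟩
  count q (allPairs N)
    ≡⟨ count-concatMap N (λ i → i) (λ i → map (i ,_) (allFin N)) q ⟩
  ∑[ i < N ] count q (map (i ,_) (allFin N))
    ≡⟨ sum-cong-≗ (λ i → trans (count-map q (i ,_) (allFin N)) (count-tabulate N (λ j → j) _)) ⟩
  ∑[ i < N ] ∑[ j < N ] [ q (i , j) ]
    ∎
  where
  open ≡-Reasoning
  q : Edge N → Bool
  q (i , j) = ((toℕ i <ᵇ toℕ j) ∧ A i j) ∧ p (i , j)

-- Distance profiles

-- withinV adj k a b says d(a, b) ≤ k, so as a function of k it is atDist d(a, b);
-- delay m adds m to the distance such a profile describes.

atDist : ℕ → ℕ → Bool
atDist zero    k       = true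
atDist (suc m) zero    = false
atDist (suc m) (suc k) = atDist m k

Monotone : (ℕ → Bool) → Set
Monotone p = ∀ j → p j ≡ true → p (suc j) ≡ true

atDist-suc : ∀ m → Monotone (atDist m)
atDist-suc zero    k       _ = refl
atDist-suc (suc m) (suc k) q = atDist-suc m k q

atDist-≤ : ∀ {m′ m} → m′ ≤ m → ∀ k → atDist m k ≡ true → atDist m′ k ≡ true
atDist-≤ z≤n      k       _ = refl
atDist-≤ (s≤s le) (suc k) q = atDist-≤ le k q

atDist⁻ : ∀ m k → atDist m k ≡ true → ∃ λ t → k ≡ t + m
atDist⁻ zero    k       _ = k , sym (+-identityʳ k)
atDist⁻ (suc m) (suc k) q with atDist⁻ m k q
... | t , refl = t , sym (+-suc t m)

atDist-⊓ : ∀ a b j → atDist a j ∨ atDist b j ≡ atDist (a ⊓ b) j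
atDist-⊓ zero    b       j       = refl
atDist-⊓ (suc a) zero    j       = ∨-zeroʳ _
atDist-⊓ (suc a) (suc b) zero    = refl
atDist-⊓ (suc a) (suc b) (suc j) = atDist-⊓ a b j

exactly-cong : ∀ {p q : ℕ → Bool} → (∀ j → p j ≡ q j) → ∀ k → exactly p k ≡ exactly q k
exactly-cong eq zero    = eq zero
exactly-cong eq (suc k) = cong₂ (λ a b → a ∧ not b) (eq (suc k)) (eq k)

exactly-atDist : ∀ m k → exactly (atDist m) k ≡ (m ≡ᵇ k)
exactly-atDist zero    zero          = refl
exactly-atDist zero    (suc k)       = refl
exactly-atDist (suc m) zero          = refl
exactly-atDist (suc m) (suc zero)    = trans (∧-identityʳ _) (exactly-atDist m zero)
exactly-atDist (suc m) (suc (suc k)) = exactly-atDist m (suc k)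

exactly-≡atDist : ∀ {p : ℕ → Bool} m → (∀ j → p j ≡ atDist m j) → ∀ k → [ exactly p k ] ≡ [ m ≡ᵇ k ]
exactly-≡atDist m eq k = cong [_] (trans (exactly-cong eq k) (exactly-atDist m k))

atDist-suc-from : ∀ {p : ℕ → Bool} m → p 0 ≡ false → (∀ j → p (suc j) ≡ atDist m j) →
                  ∀ j → p j ≡ atDist (suc m) j
atDist-suc-from m p0 _  zero    = p0
atDist-suc-from m _  ps (suc j) = ps j

delay : ℕ → (ℕ → Bool) → ℕ → Bool
delay zero    p k       = p k
delay (suc m) p zero    = false
delay (suc m) p (suc k) = delay m p k

delay-suc : ∀ {p : ℕ → Bool} m → Monotone p → Monotone (delay m p)
delay-suc zero    mono k       r = mono k r
delay-suc (suc m) mono (suc k) r = delay-suc m mono k r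

module _ {p q : ℕ → Bool} where

  delay-step : ∀ m → (∀ j → p j ≡ true → q (suc j) ≡ true) →
               ∀ k → delay m p k ≡ true → delay m q (suc k) ≡ true
  delay-step zero    f k       r = f k r
  delay-step (suc m) f (suc k) r = delay-step m f k r

  delay-shift : ∀ m → (∀ j → p j ≡ true → q (suc j) ≡ true) →
                ∀ k → delay (suc m) p k ≡ true → delay m q k ≡ true
  delay-shift zero    f (suc k) r = f k r
  delay-shift (suc m) f (suc k) r = delay-shift m f k r

  delay-∨ : ∀ m k → delay m p k ∨ delay m q k ≡ delay m (λ j → p j ∨ q j) k
  delay-∨ zero    k       = refl
  delay-∨ (suc m) zero    = refl
  delay-∨ (suc m) (suc k) = delay-∨ m k

  delay-cong : (∀ j → p j ≡ q j) → ∀ m k → delay m p k ≡ delay m q k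
  delay-cong eq zero    k       = eq k
  delay-cong eq (suc m) zero    = refl
  delay-cong eq (suc m) (suc k) = delay-cong eq m k

delay⁻ : ∀ {p : ℕ → Bool} m k → delay m p k ≡ true → ∃ λ j → k ≡ j + m × p j ≡ true
delay⁻ zero    k       r = k , sym (+-identityʳ k) , r
delay⁻ (suc m) (suc k) r with delay⁻ m k r
... | j , refl , pj = j , sym (+-suc j m) , pj

delay-elim : ∀ {p : ℕ → Bool} → Monotone p → ∀ m k → delay m p k ≡ true → p k ≡ true
delay-elim mono zero    k       r = r
delay-elim mono (suc m) (suc k) r = mono k (delay-elim mono m k r)

delay-≤ : ∀ {p : ℕ → Bool} {m m′} → m ≤ m′ → Monotone p → ∀ k → delay m′ p k ≡ true → delay m p k ≡ true
delay-≤ {m′ = m′} z≤n      mono k       r = delay-elim mono m′ k r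
delay-≤           (s≤s le) mono (suc k) r = delay-≤ le mono k r

delay-true : ∀ {p : ℕ → Bool} → (∀ j → p j ≡ true) → ∀ m k → delay m p k ≡ atDist m k
delay-true always zero    k       = always k
delay-true always (suc m) zero    = refl
delay-true always (suc m) (suc k) = delay-true always m k

delay-atDist : ∀ m t k → delay m (atDist t) k ≡ atDist (m + t) k
delay-atDist zero    t k       = refl
delay-atDist (suc m) t zero    = refl
delay-atDist (suc m) t (suc k) = delay-atDist m t k

exactly-delay : ∀ m p k → exactly (delay m p) k ≡ delay m (exactly p) k
exactly-delay zero    p k             = refl
exactly-delay (suc m) p zero          = refl
exactly-delay (suc m) p (suc zero)    = trans (∧-identityʳ _) (exactly-delay m p zero)
exactly-delay (suc m) p (suc (suc k)) = exactly-delay m p (suc k)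

count-delay : ∀ {A : Set} m (E : A → ℕ → Bool) xs k →
              count (λ f → delay m (E f) k) xs ≡ shift m (λ k → count (λ f → E f k) xs) k
count-delay zero    E xs k       = refl
count-delay (suc m) E xs zero    = count-false xs
count-delay (suc m) E xs (suc k) = count-delay m E xs k

count-exactly-delay : ∀ {A : Set} m (E : A → ℕ → Bool) {p : A → ℕ → Bool} xs k →
                      (∀ f j → p f j ≡ delay m (E f) j) →
                      count (λ f → exactly (p f) k) xs ≡ shift m (λ k → count (λ f → exactly (E f) k) xs) k
count-exactly-delay m E xs k eq =
  trans (count-cong xs (λ f → trans (exactly-cong (eq f) k) (exactly-delay m (E f) k)))
        (count-delay m (λ f → exactly (E f)) xs k)

module Walks {V : Set} (eq : V → V → Bool) (vs : List V) (adj : V → V → Bool) where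

  private
    W : ℕ → V → V → Bool
    W = within eq vs adj

  within-suc : ∀ k {a b} → W k a b ≡ true → W (suc k) a b ≡ true
  within-suc k p = ∨-trueˡ _ p

  within-+ : ∀ m k {a b} → W k a b ≡ true → W (m + k) a b ≡ true
  within-+ zero    k p = p
  within-+ (suc m) k p = within-suc (m + k) (within-+ m k p)

  within-zero : ∀ k {a b} → W 0 a b ≡ true → W k a b ≡ true
  within-zero zero    p = p
  within-zero (suc k) p = within-suc k (within-zero k p)

  within-step : ∀ k {a c b} → W k a c ≡ true → c ∈ vs → adj c b ≡ true → W (suc k) a b ≡ true
  within-step k {a} {c} {b} p c∈ q =
    ∨-trueʳ (W k a b) (any-true (λ c → W k a c ∧ adj c b) vs c∈ (∧-true p q))

  within-suc⁻ : ∀ k {a b} → W (suc k) a b ≡ true →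
                W k a b ≡ true ⊎ ∃ λ c → c ∈ vs × W k a c ≡ true × adj c b ≡ true
  within-suc⁻ k {a} {b} p with ∨-true⁻ (W k a b) p
  ... | inj₁ q = inj₁ q
  ... | inj₂ q with any-true⁻ _ vs q
  ...   | c , c∈ , r = inj₂ (c , c∈ , ∧-true⁻ˡ _ r , ∧-true⁻ʳ (W k a c) r)

-- Simple graphs and their line graphs

module SimpleGraph {N : ℕ} (adj : Adj N) (simple : IsSimple adj) where

  open IsSimple simple renaming (sym to adj-sym)
  module V = Walks _==_ (allFin N) adj
  module L = Walks _=E_ (edges adj) lineAdj

  adjacent-distinct : ∀ {a b} → adj a b ≡ true → a ≢ b
  adjacent-distinct {a} e refl with trans (sym (irrefl a)) e
  ... | ()

  withinV-step : ∀ k {a c b} → withinV adj k a c ≡ true → adj c b ≡ true → withinV adj (suc k) a b ≡ true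
  withinV-step k p q = V.within-step k p (∈-allFin _) q

  withinV-refl : ∀ k a → withinV adj k a a ≡ true
  withinV-refl k a = V.within-zero k (==-refl a)

  withinV-edge : ∀ k {a b} → adj a b ≡ true → withinV adj (suc k) a b ≡ true
  withinV-edge zero    e = withinV-step 0 (==-refl _) e
  withinV-edge (suc k) e = V.within-suc (suc k) (withinV-edge k e)

  withinV-edge-atDist : ∀ {a b} → adj a b ≡ true → ∀ j → withinV adj j a b ≡ atDist 1 j
  withinV-edge-atDist e zero    = ==-false (adjacent-distinct e)
  withinV-edge-atDist e (suc j) = withinV-edge j e

  withinV-trans : ∀ m k {a b c} → withinV adj k a b ≡ true → withinV adj m b c ≡ true →
                  withinV adj (m + k) a c ≡ true
  withinV-trans zero    k {a} p q = subst (λ z → withinV adj k a z ≡ true) (==-sound q) p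
  withinV-trans (suc m) k p q with V.within-suc⁻ m q
  ... | inj₁ r               = V.within-suc (m + k) (withinV-trans m k p r)
  ... | inj₂ (c , _ , r , e) = withinV-step (m + k) (withinV-trans m k p r) e

  withinV-prepend : ∀ k {a c b} → adj a c ≡ true → withinV adj k c b ≡ true → withinV adj (suc k) a b ≡ true
  withinV-prepend k {a} {c} {b} e p =
    subst (λ m → withinV adj m a b ≡ true) (+-comm k 1) (withinV-trans k 1 (withinV-edge 0 e) p)

  ∈edges⇒adj : ∀ {a b} → (a , b) ∈ edges adj → adj a b ≡ true
  ∈edges⇒adj {a} {b} ab∈ =
    ∧-true⁻ʳ (toℕ a <ᵇ toℕ b) (Equivalence.to T-≡ (proj₂ (∈-filter⁻ _ {xs = allPairs N} ab∈)))

  ∈edges : ∀ {a b} → (toℕ a <ᵇ toℕ b) ≡ true → adj a b ≡ true → (a , b) ∈ edges adj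
  ∈edges {a} {b} a<b e = ∈-filter⁺ _ ab∈allPairs (Equivalence.from T-≡ (∧-true a<b e))
    where
    ab∈allPairs : (a , b) ∈ allPairs N
    ab∈allPairs =
      ∈-concatMap⁺ (λ i → map (i ,_) (allFin N)) (lose (∈-allFin a) (∈-map⁺ (a ,_) (∈-allFin b)))

  edge-of : ∀ {a b} → adj a b ≡ true → (a , b) ∈ edges adj ⊎ (b , a) ∈ edges adj
  edge-of {a} {b} e with <-cmp (toℕ a) (toℕ b)
  ... | tri< a<b _ _ = inj₁ (∈edges (<⇒<ᵇ≡true a<b) e)
  ... | tri≈ _ a≡b _ = ⊥-elim (adjacent-distinct e (toℕ-injective a≡b))
  ... | tri> _ _ b<a = inj₂ (∈edges (<⇒<ᵇ≡true b<a) (trans (adj-sym b a) e))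

  edge-through : ∀ {a b} → adj a b ≡ true → ∃ λ c → c ∈ edges adj × a ∈ₑ c × b ∈ₑ c
  edge-through e with edge-of e
  ... | inj₁ ab∈ = _ , ab∈ , inj₁ refl , inj₂ refl
  ... | inj₂ ba∈ = _ , ba∈ , inj₂ refl , inj₁ refl

  withinVE-intro : ∀ k {w z} f → withinV adj k w z ≡ true → z ∈ₑ f → withinVE adj k w f ≡ true
  withinVE-intro k (x , y) p (inj₁ refl) = ∨-trueˡ _ p
  withinVE-intro k (x , y) p (inj₂ refl) = ∨-trueʳ _ p

  withinVE⁻ : ∀ k w f → withinVE adj k w f ≡ true → ∃ λ z → z ∈ₑ f × withinV adj k w z ≡ true
  withinVE⁻ k w (x , y) p with ∨-true⁻ (withinV adj k w x) p
  ... | inj₁ q = x , inj₁ refl , q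
  ... | inj₂ q = y , inj₂ refl , q

  withinVE-suc : ∀ w f → Monotone (λ k → withinVE adj k w f)
  withinVE-suc w f k p with withinVE⁻ k w f p
  ... | z , z∈ , q = withinVE-intro (suc k) f (V.within-suc k q) z∈

  withinVE-across : ∀ k {w c₁ c₂} f → adj c₁ c₂ ≡ true → withinVE adj k w (c₁ , c₂) ≡ true →
                    lineAdj (c₁ , c₂) f ≡ true → withinVE adj (suc k) w f ≡ true
  withinVE-across k {w} {c₁} {c₂} f e near shares with lineAdj-shared _ f shares | withinVE⁻ k w _ near
  ... | _ , inj₁ refl , z∈f | _ , inj₁ refl , q = withinVE-intro (suc k) f (V.within-suc k q) z∈f
  ... | _ , inj₂ refl , z∈f | _ , inj₂ refl , q = withinVE-intro (suc k) f (V.within-suc k q) z∈f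
  ... | _ , inj₁ refl , z∈f | _ , inj₂ refl , q =
    withinVE-intro (suc k) f (withinV-step k q (trans (adj-sym c₂ c₁) e)) z∈f
  ... | _ , inj₂ refl , z∈f | _ , inj₁ refl , q = withinVE-intro (suc k) f (withinV-step k q e) z∈f

  endsWithin : ℕ → Fin N → Fin N → Edge N → Bool
  endsWithin k a b f = withinVE adj k a f ∨ withinVE adj k b f

  endsWithin-suc : ∀ a b f → Monotone (λ k → endsWithin k a b f)
  endsWithin-suc a b f k p with ∨-true⁻ (withinVE adj k a f) p
  ... | inj₁ q = ∨-trueˡ (withinVE adj (suc k) b f) (withinVE-suc a f k q)
  ... | inj₂ q = ∨-trueʳ (withinVE adj (suc k) a f) (withinVE-suc b f k q)

  =E⇒endsWithin : ∀ k {a b} f → ((a , b) =E f) ≡ true → endsWithin k a b f ≡ true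
  =E⇒endsWithin k {a} {b} f ab=f =
    ∨-trueˡ (withinVE adj k b f) (withinVE-intro k f (withinV-refl k a) (=E-∈ₑ ab=f (inj₁ refl)))

  endsWithin-shared : ∀ k {a b} c f → ((a , b) =E c) ≡ true → lineAdj c f ≡ true → endsWithin k a b f ≡ true
  endsWithin-shared k {a} {b} c f ab=c shares with lineAdj-shared c f shares
  ... | z , z∈c , z∈f with =E-∈ₑ (trans (=E-sym c (a , b)) ab=c) z∈c
  ...   | inj₁ refl = ∨-trueˡ (withinVE adj k b f) (withinVE-intro k f (withinV-refl k z) z∈f)
  ...   | inj₂ refl = ∨-trueʳ (withinVE adj k a f) (withinVE-intro k f (withinV-refl k z) z∈f)

  endsWithin-across : ∀ k {a b} c f → c ∈ edges adj → endsWithin k a b c ≡ true → lineAdj c f ≡ true →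
                      endsWithin (suc k) a b f ≡ true
  endsWithin-across k {a} {b} (c₁ , c₂) f c∈ p shares with ∨-true⁻ (withinVE adj k a (c₁ , c₂)) p
  ... | inj₁ q = ∨-trueˡ (withinVE adj (suc k) b f) (withinVE-across k f (∈edges⇒adj c∈) q shares)
  ... | inj₂ q = ∨-trueʳ (withinVE adj (suc k) a f) (withinVE-across k f (∈edges⇒adj c∈) q shares)

  withinE-suc⁻ : ∀ k {a b} f → withinE adj (suc k) (a , b) f ≡ true → endsWithin k a b f ≡ true
  withinE-suc⁻ k {a} {b} f p with L.within-suc⁻ k p
  withinE-suc⁻ zero    {a} {b} f p | inj₁ q = =E⇒endsWithin 0 {a} {b} f q
  withinE-suc⁻ (suc k) {a} {b} f p | inj₁ q = endsWithin-suc a b f k (withinE-suc⁻ k f q)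
  withinE-suc⁻ zero    {a} {b} f p | inj₂ (c , _  , q , shares) = endsWithin-shared 0 {a} {b} c f q shares
  withinE-suc⁻ (suc k) {a} {b} f p | inj₂ (c , c∈ , q , shares) =
    endsWithin-across k {a} {b} c f c∈ (withinE-suc⁻ k c q) shares

  withinE-from-walk : ∀ k {a b w z} f → adj a b ≡ true → w ∈ₑ (a , b) → withinV adj k w z ≡ true → z ∈ₑ f →
                      withinE adj (suc k) (a , b) f ≡ true
  withinE-from-walk zero {a} {b} f e w∈ p z∈ with ==-sound p | true⊎false ((a , b) =E f)
  ... | refl | inj₁ ab=f = L.within-suc 0 {a , b} {f} ab=f
  ... | refl | inj₂ ab≠f with edge-of e
  ...   | inj₁ ab∈ = L.within-step 0 {a , b} {a , b} {f} (=E-refl (a , b)) ab∈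
                       (lineAdj-intro (a , b) f ab≠f w∈ z∈)
  ...   | inj₂ ba∈ = L.within-step 0 {a , b} {b , a} {f} (=E-swap a b) ba∈
                       (lineAdj-intro (b , a) f (trans (=E-swapˡ a b f) ab≠f) (∈ₑ-swap w∈) z∈)
  withinE-from-walk (suc k) {a} {b} f e w∈ p z∈ with V.within-suc⁻ k p
  ... | inj₁ q = L.within-suc (suc k) {a , b} {f} (withinE-from-walk k f e w∈ q z∈)
  ... | inj₂ (y , _ , q , yz) with edge-through yz
  ...   | c , c∈ , y∈c , z∈c with true⊎false (c =E f)
  ...     | inj₁ c=f = L.within-suc (suc k) {a , b} {f} (withinE-from-walk k f e w∈ q (=E-∈ₑ c=f y∈c))
  ...     | inj₂ c≠f = L.within-step (suc k) {a , b} {c} {f} (withinE-from-walk k c e w∈ q y∈c) c∈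
                         (lineAdj-intro c f c≠f z∈c z∈)

  withinE-from-endpoint : ∀ k {a b w} f → adj a b ≡ true → w ∈ₑ (a , b) → withinVE adj k w f ≡ true →
                          withinE adj (suc k) (a , b) f ≡ true
  withinE-from-endpoint k {w = w} f e w∈ p with withinVE⁻ k w f p
  ... | z , z∈ , q = withinE-from-walk k f e w∈ q z∈

  withinE-suc : ∀ {a b} → adj a b ≡ true → ∀ k f → withinE adj (suc k) (a , b) f ≡ endsWithin k a b f
  withinE-suc {a} {b} e k f = bool-ext (withinE-suc⁻ k f) from-ends
    where
    from-ends : endsWithin k a b f ≡ true → withinE adj (suc k) (a , b) f ≡ true
    from-ends p with ∨-true⁻ (withinVE adj k a f) p
    ... | inj₁ q = withinE-from-endpoint k f e (inj₁ refl) q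
    ... | inj₂ q = withinE-from-endpoint k f e (inj₂ refl) q

  count-=E : ∀ {a b} → adj a b ≡ true → count ((a , b) =E_) (edges adj) ≡ 1
  count-=E {a} {b} e = begin
    count ((a , b) =E_) (edges adj)
      ≡⟨ count-edges adj _ ⟩
    ∑[ i < N ] ∑[ j < N ] [ ordered i j ∧ ((a , b) =E (i , j)) ]
      ≡⟨ sum-cong-≗ (λ i → trans (sum-cong-≗ (split i)) (∑-distrib-+ (straight i) (reversed i))) ⟩
    ∑[ i < N ] (∑[ j < N ] straight i j + ∑[ j < N ] reversed i j)
      ≡⟨ ∑-distrib-+ (λ i → ∑[ j < N ] straight i j) (λ i → ∑[ j < N ] reversed i j) ⟩
    ∑[ i < N ] ∑[ j < N ] straight i j + ∑[ i < N ] ∑[ j < N ] reversed i j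
      ≡⟨ cong₂ _+_ (sum-pick₂ a b ordered) (sum-pick₂ b a ordered) ⟩
    [ ordered a b ] + [ ordered b a ]
      ≡⟨ one-way ⟩
    1 ∎
    where
    open ≡-Reasoning
    ordered : Fin N → Fin N → Bool
    ordered i j = (toℕ i <ᵇ toℕ j) ∧ adj i j

    straight reversed : Fin N → Fin N → ℕ
    straight i j = [ ((a == i) ∧ (b == j)) ∧ ordered i j ]
    reversed i j = [ ((b == i) ∧ (a == j)) ∧ ordered i j ]

    split : ∀ i j → [ ordered i j ∧ ((a , b) =E (i , j)) ] ≡ straight i j + reversed i j
    split i j = begin
      [ o ∧ (d₁ ∨ d₂) ]         ≡⟨ cong [_] (∧-distribˡ-∨ o d₁ d₂) ⟩
      [ (o ∧ d₁) ∨ (o ∧ d₂) ]   ≡⟨ [∨] (o ∧ d₁) (o ∧ d₂) disjoint ⟩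
      [ o ∧ d₁ ] + [ o ∧ d₂ ]   ≡⟨ cong₂ _+_ (cong [_] (∧-comm o d₁))
                                              (cong [_] (trans (∧-comm o d₂) (cong (_∧ o) (∧-comm (a == j) (b == i))))) ⟩
      [ d₁ ∧ o ] + [ ((b == i) ∧ (a == j)) ∧ o ] ∎
      where
      o  = ordered i j
      d₁ = (a == i) ∧ (b == j)
      d₂ = (a == j) ∧ (b == i)
      disjoint : o ∧ d₁ ≡ true → o ∧ d₂ ≡ true → ⊥
      disjoint p q = adjacent-distinct e
        (trans (==-sound (∧-true⁻ˡ _ (∧-true⁻ʳ o p))) (sym (==-sound (∧-true⁻ʳ (a == j) (∧-true⁻ʳ o q)))))

    one-way : [ ordered a b ] + [ ordered b a ] ≡ 1
    one-way rewrite e | trans (adj-sym b a) e | ∧-identityʳ (toℕ a <ᵇ toℕ b) | ∧-identityʳ (toℕ b <ᵇ toℕ a) =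
      <ᵇ-one-way (toℕ a) (toℕ b) (adjacent-distinct e ∘ toℕ-injective)

  HeE-one : ∀ {a b} → adj a b ≡ true → HeE adj (a , b) 1 + 1 ≡ count (endsWithin 0 a b) (edges adj)
  HeE-one {a} {b} e = sym (begin
    count (endsWithin 0 a b) (edges adj)
      ≡⟨ count-split _ ((a , b) =E_) (edges adj) ⟩
    count (λ f → endsWithin 0 a b f ∧ not ((a , b) =E f)) (edges adj)
      + count (λ f → endsWithin 0 a b f ∧ ((a , b) =E f)) (edges adj)
      ≡⟨ cong₂ _+_ (count-cong (edges adj) (λ f → cong (λ c → c ∧ not ((a , b) =E f)) (sym (withinE-suc e 0 f))))
                   (trans (count-cong (edges adj) ends∧=E) (count-=E e)) ⟩
    HeE adj (a , b) 1 + 1 ∎)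
    where
    open ≡-Reasoning
    ends∧=E : ∀ f → endsWithin 0 a b f ∧ ((a , b) =E f) ≡ ((a , b) =E f)
    ends∧=E f with true⊎false ((a , b) =E f)
    ... | inj₁ ab=f rewrite ab=f | =E⇒endsWithin 0 {a} {b} f ab=f = refl
    ... | inj₂ ab≠f rewrite ab≠f = ∧-zeroʳ _

  HeE-suc-suc : ∀ {a b} → adj a b ≡ true → ∀ k →
                HeE adj (a , b) (suc (suc k)) ≡ count (λ f → exactly (λ i → endsWithin i a b f) (suc k)) (edges adj)
  HeE-suc-suc e k =
    count-cong (edges adj) λ f → cong₂ (λ x y → x ∧ not y) (withinE-suc e (suc k) f) (withinE-suc e k f)

pattern P = F.zero
pattern Q = F.suc F.zero
pattern R = F.suc (F.suc F.zero)
pattern S = F.suc (F.suc (F.suc F.zero))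

dn : Fin 4 → Fin 4 → ℕ
dn x y = ∣ toℕ x - toℕ y ∣

consecutive-dist : ∀ m n → ((suc m ≡ᵇ n) ∨ (suc n ≡ᵇ m)) ≡ true → ∣ m - n ∣ ≡ 1
consecutive-dist zero          (suc zero)    _ = refl
consecutive-dist (suc zero)    zero          _ = refl
consecutive-dist (suc m)       (suc n)       e = consecutive-dist m n e
consecutive-dist zero          zero          ()
consecutive-dist zero          (suc (suc n)) ()
consecutive-dist (suc (suc m)) zero          ()

dn-step : ∀ x {i y} → pathAdj i y ≡ true → dn x y ≤ suc (dn x i)
dn-step x {i} {y} e =
  subst (dn x y ≤_) (trans (cong (dn x i +_) (consecutive-dist (toℕ i) (toℕ y) e)) (+-comm (dn x i) 1))
        (∣-∣-triangle (toℕ x) (toℕ i) (toℕ y))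

-- Distances in G from the path vertex x to u and to v: leave the path at p (to u) or at s (to v),
-- and reach the farther of u, v through the edge uv.

viaP viaS toU toV : Fin 4 → ℕ
viaP x = suc (dn x P)
viaS x = suc (dn x S)
toU x = viaP x ⊓ suc (viaS x)
toV x = suc (viaP x) ⊓ viaS x

dn-P≤ : ∀ x → dn x P ≤ suc (toU x)
dn-P≤ x = ⊓-glb {y = suc (viaP x)} {z = suc (suc (viaS x))} (≤-trans (n≤1+n _) (n≤1+n _))
                (subst (dn x P ≤_) (+-comm (dn x S) 3) (∣-∣-triangle (toℕ x) 3 0))

dn-S≤ : ∀ x → dn x S ≤ suc (toV x)
dn-S≤ x = ⊓-glb {y = suc (suc (viaP x))} {z = suc (viaS x)}
                (subst (dn x S ≤_) (+-comm (dn x P) 3) (∣-∣-triangle (toℕ x) 0 3))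
                (≤-trans (n≤1+n _) (n≤1+n _))

-- Distances from x to the edges up and sv, and between edges of the path.

crossU crossV : Fin 4 → ℕ
crossU x = toU x ⊓ dn x P
crossV x = toV x ⊓ dn x S

pathEdgeDist : Edge 4 → Edge 4 → ℕ
pathEdgeDist (x , y) (a , b) = if (x , y) =E (a , b) then 0 else suc ((dn x a ⊓ dn x b) ⊓ (dn y a ⊓ dn y b))

-- Coefficients contributed by the five new edges up, sv, pq, qr, rs.

vertexProfile : Fin 4 → ℕ → ℕ
vertexProfile x k = ([ crossU x ≡ᵇ k ] + [ crossV x ≡ᵇ k ])
                  + ([ dn x P ⊓ dn x Q ≡ᵇ k ] + ([ dn x Q ⊓ dn x R ≡ᵇ k ] + [ dn x R ⊓ dn x S ≡ᵇ k ]))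

edgeProfile : Fin 4 → Fin 4 → ℕ → ℕ
edgeProfile x y k = ([ suc (crossU x ⊓ crossU y) ≡ᵇ k ] + [ suc (crossV x ⊓ crossV y) ≡ᵇ k ])
                  + ([ pathEdgeDist (x , y) (P , Q) ≡ᵇ k ]
                     + ([ pathEdgeDist (x , y) (Q , R) ≡ᵇ k ] + [ pathEdgeDist (x , y) (R , S) ≡ᵇ k ]))

vertexProfile-P : ∀ k → vertexProfile P k ≡ poly (2 ∷ 1 ∷ 2 ∷ []) k
vertexProfile-P 0                   = refl
vertexProfile-P 1                   = refl
vertexProfile-P 2                   = refl
vertexProfile-P (suc (suc (suc k))) = refl

vertexProfile-Q : ∀ k → vertexProfile Q k ≡ poly (2 ∷ 2 ∷ 1 ∷ []) k
vertexProfile-Q 0                   = refl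
vertexProfile-Q 1                   = refl
vertexProfile-Q 2                   = refl
vertexProfile-Q (suc (suc (suc k))) = refl

vertexProfile-R : ∀ k → vertexProfile R k ≡ poly (2 ∷ 2 ∷ 1 ∷ []) k
vertexProfile-R 0                   = refl
vertexProfile-R 1                   = refl
vertexProfile-R 2                   = refl
vertexProfile-R (suc (suc (suc k))) = refl

vertexProfile-S : ∀ k → vertexProfile S k ≡ poly (2 ∷ 1 ∷ 2 ∷ []) k
vertexProfile-S 0                   = refl
vertexProfile-S 1                   = refl
vertexProfile-S 2                   = refl
vertexProfile-S (suc (suc (suc k))) = refl

edgeProfile-PQ : ∀ k → edgeProfile P Q k ≡ poly (1 ∷ 2 ∷ 1 ∷ 1 ∷ []) k
edgeProfile-PQ 0                         = refl
edgeProfile-PQ 1                         = refl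
edgeProfile-PQ 2                         = refl
edgeProfile-PQ 3                         = refl
edgeProfile-PQ (suc (suc (suc (suc k)))) = refl

edgeProfile-RS : ∀ k → edgeProfile R S k ≡ poly (1 ∷ 2 ∷ 1 ∷ 1 ∷ []) k
edgeProfile-RS 0                         = refl
edgeProfile-RS 1                         = refl
edgeProfile-RS 2                         = refl
edgeProfile-RS 3                         = refl
edgeProfile-RS (suc (suc (suc (suc k)))) = refl

-- The extended graph

module Extension {n : ℕ} (adj : Adj n) (simple : IsSimple adj) (u v : Fin n) (uv : adj u v ≡ true) where

  open IsSimple simple renaming (sym to adj-sym)

  G : Adj (n + 4)
  G = extend adj u v

  new : Fin 4 → Fin (n + 4)
  new i = n ↑ʳ i

  oldE : Edge n → Edge (n + 4)
  oldE (a , b) = old a , old b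

  G-old-old : ∀ a b → G (old a) (old b) ≡ adj a b
  G-old-old a b rewrite splitAt-↑ˡ n a 4 | splitAt-↑ˡ n b 4 = refl

  G-old-new : ∀ a i → G (old a) (new i) ≡ crossAdj u v a i
  G-old-new a i rewrite splitAt-↑ˡ n a 4 | splitAt-↑ʳ n 4 i = refl

  G-new-old : ∀ i b → G (new i) (old b) ≡ crossAdj u v b i
  G-new-old i b rewrite splitAt-↑ʳ n 4 i | splitAt-↑ˡ n b 4 = refl

  G-new-new : ∀ i j → G (new i) (new j) ≡ pathAdj i j
  G-new-new i j rewrite splitAt-↑ʳ n 4 i | splitAt-↑ʳ n 4 j = refl

  old-or-new : ∀ x → (∃ λ a → x ≡ old a) ⊎ (∃ λ i → x ≡ new i)
  old-or-new x with splitAt n x in eq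
  ... | inj₁ a = inj₁ (a , sym (splitAt⁻¹-↑ˡ eq))
  ... | inj₂ i = inj₂ (i , sym (splitAt⁻¹-↑ʳ eq))

  ==-old-old : ∀ (a b : Fin n) → (old a == old b) ≡ (a == b)
  ==-old-old a b =
    bool-ext (λ p → ==-true (↑ˡ-injective 4 a b (==-sound p))) (λ p → ==-true (cong old (==-sound p)))

  ==-new-new : ∀ i j → (new i == new j) ≡ (i == j)
  ==-new-new i j =
    bool-ext (λ p → ==-true (↑ʳ-injective n i j (==-sound p))) (λ p → ==-true (cong new (==-sound p)))

  ==-new-old : ∀ i (a : Fin n) → (new i == old a) ≡ false
  ==-new-old i a = ==-false λ new≡old →
    case trans (sym (splitAt-↑ʳ n 4 i)) (trans (cong (splitAt n) new≡old) (splitAt-↑ˡ n a 4)) of λ ()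

  crossAdj-P : ∀ a → crossAdj u v a P ≡ (a == u)
  crossAdj-P a rewrite ∧-identityʳ (a == u) | ∧-zeroʳ (a == v) = ∨-identityʳ _

  crossAdj-Q : ∀ a → crossAdj u v a Q ≡ false
  crossAdj-Q a rewrite ∧-zeroʳ (a == u) | ∧-zeroʳ (a == v) = refl

  crossAdj-R : ∀ a → crossAdj u v a R ≡ false
  crossAdj-R a rewrite ∧-zeroʳ (a == u) | ∧-zeroʳ (a == v) = refl

  crossAdj-S : ∀ a → crossAdj u v a S ≡ (a == v)
  crossAdj-S a rewrite ∧-zeroʳ (a == u) = ∧-identityʳ _

  crossAdj⁻ : ∀ a i → crossAdj u v a i ≡ true → (i ≡ P × a ≡ u) ⊎ (i ≡ S × a ≡ v)
  crossAdj⁻ a P e = inj₁ (refl , ==-sound (trans (sym (crossAdj-P a)) e))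
  crossAdj⁻ a Q e = case trans (sym (crossAdj-Q a)) e of λ ()
  crossAdj⁻ a R e = case trans (sym (crossAdj-R a)) e of λ ()
  crossAdj⁻ a S e = inj₂ (refl , ==-sound (trans (sym (crossAdj-S a)) e))

  pathAdj-irrefl : ∀ i → pathAdj i i ≡ false
  pathAdj-irrefl P = refl
  pathAdj-irrefl Q = refl
  pathAdj-irrefl R = refl
  pathAdj-irrefl S = refl

  G-simple : IsSimple G
  G-simple = record { sym = G-sym ; irrefl = G-irrefl }
    where
    G-sym : ∀ x y → G x y ≡ G y x
    G-sym x y with old-or-new x | old-or-new y
    ... | inj₁ (a , refl) | inj₁ (b , refl) = trans (G-old-old a b) (trans (adj-sym a b) (sym (G-old-old b a)))
    ... | inj₁ (a , refl) | inj₂ (j , refl) = trans (G-old-new a j) (sym (G-new-old j a))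
    ... | inj₂ (i , refl) | inj₁ (b , refl) = trans (G-new-old i b) (sym (G-old-new b i))
    ... | inj₂ (i , refl) | inj₂ (j , refl) =
      trans (G-new-new i j) (trans (∨-comm (suc (toℕ i) ≡ᵇ toℕ j) _) (sym (G-new-new j i)))
    G-irrefl : ∀ x → G x x ≡ false
    G-irrefl x with old-or-new x
    ... | inj₁ (a , refl) = trans (G-old-old a a) (irrefl a)
    ... | inj₂ (i , refl) = trans (G-new-new i i) (pathAdj-irrefl i)

  module G₀ = SimpleGraph adj simple
  module Gᵉ = SimpleGraph G G-simple

  vu : adj v u ≡ true
  vu = trans (adj-sym v u) uv

  lift-walk : ∀ k {a b} → withinV adj k a b ≡ true → withinV G k (old a) (old b) ≡ true
  lift-walk zero    {a} {b} p = trans (==-old-old a b) p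
  lift-walk (suc k) {a} {b} p with G₀.V.within-suc⁻ k p
  ... | inj₁ q               = Gᵉ.V.within-suc k (lift-walk k q)
  ... | inj₂ (c , _ , q , e) = Gᵉ.withinV-step k (lift-walk k q) (trans (G-old-old c b) e)

  -- A walk from new x to old a leaves the path through u after viaP x steps
  -- or through v after viaS x steps.
  throughEnds : Fin 4 → Fin n → ℕ → Bool
  throughEnds x a k =
    delay (viaP x) (λ j → withinV adj j u a) k ∨ delay (viaS x) (λ j → withinV adj j v a) k

  throughEnds-suc : ∀ x a → Monotone (throughEnds x a)
  throughEnds-suc x a k p with ∨-true⁻ (delay (viaP x) (λ j → withinV adj j u a) k) p
  ... | inj₁ q = ∨-trueˡ (delay (viaS x) (λ j → withinV adj j v a) (suc k))
                         (delay-suc (viaP x) (λ j → G₀.V.within-suc j) k q)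
  ... | inj₂ q = ∨-trueʳ (delay (viaP x) (λ j → withinV adj j u a) (suc k))
                         (delay-suc (viaS x) (λ j → G₀.V.within-suc j) k q)

  throughEnds-step : ∀ x {b a} k → throughEnds x b k ≡ true → adj b a ≡ true → throughEnds x a (suc k) ≡ true
  throughEnds-step x {b} {a} k p e with ∨-true⁻ (delay (viaP x) (λ j → withinV adj j u b) k) p
  ... | inj₁ q = ∨-trueˡ (delay (viaS x) (λ j → withinV adj j v a) (suc k))
                         (delay-step (viaP x) (λ j r → G₀.withinV-step j r e) k q)
  ... | inj₂ q = ∨-trueʳ (delay (viaP x) (λ j → withinV adj j u a) (suc k))
                         (delay-step (viaS x) (λ j r → G₀.withinV-step j r e) k q)

  throughEnds-u : ∀ x k → throughEnds x u k ≡ atDist (toU x) k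
  throughEnds-u x k = begin
    throughEnds x u k
      ≡⟨ cong₂ _∨_ (delay-true (λ j → G₀.withinV-refl j u) (viaP x) k)
                   (trans (delay-cong (G₀.withinV-edge-atDist vu) (viaS x) k) (delay-atDist (viaS x) 1 k)) ⟩
    atDist (viaP x) k ∨ atDist (viaS x + 1) k
      ≡⟨ cong (λ t → atDist (viaP x) k ∨ atDist t k) (+-comm (viaS x) 1) ⟩
    atDist (viaP x) k ∨ atDist (suc (viaS x)) k
      ≡⟨ atDist-⊓ (viaP x) (suc (viaS x)) k ⟩
    atDist (toU x) k ∎
    where open ≡-Reasoning

  throughEnds-v : ∀ x k → throughEnds x v k ≡ atDist (toV x) k
  throughEnds-v x k = begin
    throughEnds x v k
      ≡⟨ cong₂ _∨_ (trans (delay-cong (G₀.withinV-edge-atDist uv) (viaP x) k) (delay-atDist (viaP x) 1 k))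
                   (delay-true (λ j → G₀.withinV-refl j v) (viaS x) k) ⟩
    atDist (viaP x + 1) k ∨ atDist (viaS x) k
      ≡⟨ cong (λ s → atDist s k ∨ atDist (viaS x) k) (+-comm (viaP x) 1) ⟩
    atDist (suc (viaP x)) k ∨ atDist (viaS x) k
      ≡⟨ atDist-⊓ (suc (viaP x)) (viaS x) k ⟩
    atDist (toV x) k ∎
    where open ≡-Reasoning

  -- Wrapping the walk in a record keeps its endpoints inferable: withinV G k (new x) (new i) ≡ true
  -- computes, and _▸_ could not recover i from it.
  record PathWalk (k : ℕ) (x i : Fin 4) : Set where
    constructor walk
    field reaches : withinV G k (new x) (new i) ≡ true

  start : ∀ x → PathWalk 0 x x
  start x = walk (Gᵉ.withinV-refl 0 (new x))

  infixl 5 _▸_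
  _▸_ : ∀ {k x i} → PathWalk k x i → (j : Fin 4) → {T (pathAdj i j)} → PathWalk (suc k) x j
  _▸_ {k} {i = i} (walk w) j {i~j} =
    walk (Gᵉ.withinV-step k w (trans (G-new-new i j) (Equivalence.to T-≡ i~j)))

  path-walk : ∀ x y → withinV G (dn x y) (new x) (new y) ≡ true
  path-walk x y = PathWalk.reaches (along x y)
    where
    along : ∀ x y → PathWalk (dn x y) x y
    along P P = start P
    along P Q = start P ▸ Q
    along P R = start P ▸ Q ▸ R
    along P S = start P ▸ Q ▸ R ▸ S
    along Q P = start Q ▸ P
    along Q Q = start Q
    along Q R = start Q ▸ R
    along Q S = start Q ▸ R ▸ S
    along R P = start R ▸ Q ▸ P
    along R Q = start R ▸ Q
    along R R = start R
    along R S = start R ▸ S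
    along S P = start S ▸ R ▸ Q ▸ P
    along S Q = start S ▸ R ▸ Q
    along S R = start S ▸ R
    along S S = start S

  withinV-new⁻ : ∀ k x → (∀ a → withinV G k (new x) (old a) ≡ true → throughEnds x a k ≡ true)
                         × (∀ y → withinV G k (new x) (new y) ≡ true → atDist (dn x y) k ≡ true)
  withinV-new⁻ zero x = (λ a p → case trans (sym (==-new-old x a)) p of λ ()) , same-vertex
    where
    same-vertex : ∀ y → withinV G 0 (new x) (new y) ≡ true → atDist (dn x y) 0 ≡ true
    same-vertex y p with ↑ʳ-injective n x y (==-sound p)
    ... | refl = subst (λ d → atDist d 0 ≡ true) (sym (∣n-n∣≡0 (toℕ x))) refl
  withinV-new⁻ (suc k) x = to-old , to-new
    where
    ih-old : ∀ a → withinV G k (new x) (old a) ≡ true → throughEnds x a k ≡ true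
    ih-old = proj₁ (withinV-new⁻ k x)

    ih-new : ∀ y → withinV G k (new x) (new y) ≡ true → atDist (dn x y) k ≡ true
    ih-new = proj₂ (withinV-new⁻ k x)

    to-old : ∀ a → withinV G (suc k) (new x) (old a) ≡ true → throughEnds x a (suc k) ≡ true
    to-old a p with Gᵉ.V.within-suc⁻ k p
    ... | inj₁ q = throughEnds-suc x a k (ih-old a q)
    ... | inj₂ (c , _ , q , e) with old-or-new c
    ...   | inj₁ (b , refl) = throughEnds-step x k (ih-old b q) (trans (sym (G-old-old b a)) e)
    ...   | inj₂ (i , refl) with crossAdj⁻ a i (trans (sym (G-new-old i a)) e)
    ...     | inj₁ (refl , refl) = ∨-trueˡ (delay (viaS x) (λ j → withinV adj j v u) (suc k))
                                     (trans (delay-true (λ j → G₀.withinV-refl j u) (dn x P) k) (ih-new P q))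
    ...     | inj₂ (refl , refl) = ∨-trueʳ (delay (viaP x) (λ j → withinV adj j u v) (suc k))
                                     (trans (delay-true (λ j → G₀.withinV-refl j v) (dn x S) k) (ih-new S q))

    to-new : ∀ y → withinV G (suc k) (new x) (new y) ≡ true → atDist (dn x y) (suc k) ≡ true
    to-new y p with Gᵉ.V.within-suc⁻ k p
    ... | inj₁ q = atDist-suc (dn x y) k (ih-new y q)
    ... | inj₂ (c , _ , q , e) with old-or-new c
    ...   | inj₂ (i , refl) = atDist-≤ (dn-step x (trans (sym (G-new-new i y)) e)) (suc k) (ih-new i q)
    ...   | inj₁ (b , refl) with crossAdj⁻ b y (trans (sym (G-old-new b y)) e)
    ...     | inj₁ (refl , refl) = atDist-≤ (dn-P≤ x) (suc k) (trans (sym (throughEnds-u x k)) (ih-old u q))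
    ...     | inj₂ (refl , refl) = atDist-≤ (dn-S≤ x) (suc k) (trans (sym (throughEnds-v x k)) (ih-old v q))

  walk-to-u : ∀ x → withinV G (viaP x) (new x) (old u) ≡ true
  walk-to-u x =
    Gᵉ.withinV-step (dn x P) (path-walk x P) (trans (G-new-old P u) (trans (crossAdj-P u) (==-refl u)))

  walk-to-v : ∀ x → withinV G (viaS x) (new x) (old v) ≡ true
  walk-to-v x =
    Gᵉ.withinV-step (dn x S) (path-walk x S) (trans (G-new-old S v) (trans (crossAdj-S v) (==-refl v)))

  throughEnds⇒withinV : ∀ x a k → throughEnds x a k ≡ true → withinV G k (new x) (old a) ≡ true
  throughEnds⇒withinV x a k p with ∨-true⁻ (delay (viaP x) (λ j → withinV adj j u a) k) p
  ... | inj₁ q with delay⁻ (viaP x) k q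
  ...   | j , refl , r = Gᵉ.withinV-trans j (viaP x) (walk-to-u x) (lift-walk j r)
  throughEnds⇒withinV x a k p | inj₂ q with delay⁻ (viaS x) k q
  ...   | j , refl , r = Gᵉ.withinV-trans j (viaS x) (walk-to-v x) (lift-walk j r)

  withinV-new-old : ∀ x a k → withinV G k (new x) (old a) ≡ throughEnds x a k
  withinV-new-old x a k = bool-ext (proj₁ (withinV-new⁻ k x) a) (throughEnds⇒withinV x a k)

  withinV-new-new : ∀ x y k → withinV G k (new x) (new y) ≡ atDist (dn x y) k
  withinV-new-new x y k = bool-ext (proj₂ (withinV-new⁻ k x) y) from-atDist
    where
    from-atDist : atDist (dn x y) k ≡ true → withinV G k (new x) (new y) ≡ true
    from-atDist p with atDist⁻ (dn x y) k p
    ... | t , refl = Gᵉ.V.within-+ t (dn x y) (path-walk x y)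

  dominated : ∀ {w w′ m m′} → adj w w′ ≡ true → m ≤ m′ → ∀ a k →
              delay (suc m′) (λ j → withinV adj j w′ a) k ≡ true → delay m (λ j → withinV adj j w a) k ≡ true
  dominated {m′ = m′} e m≤m′ a k p =
    delay-≤ m≤m′ (λ j → G₀.V.within-suc j) k (delay-shift m′ (λ j → G₀.withinV-prepend j e) k p)

  -- The route through nearest x, of length depth x, dominates the other one.
  nearest : Fin 4 → Fin n
  nearest P = u
  nearest Q = u
  nearest R = v
  nearest S = v

  depth : Fin 4 → ℕ
  depth P = 1
  depth Q = 2
  depth R = 2
  depth S = 1

  withinV-new-old-nearest : ∀ x a k →
                            withinV G k (new x) (old a) ≡ delay (depth x) (λ j → withinV adj j (nearest x) a) k
  withinV-new-old-nearest P a k = trans (withinV-new-old P a k) (∨-absorbʳ (dominated uv (s≤s z≤n) a k))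
  withinV-new-old-nearest Q a k = trans (withinV-new-old Q a k) (∨-absorbʳ (dominated uv ≤-refl a k))
  withinV-new-old-nearest R a k = trans (withinV-new-old R a k) (∨-absorbˡ (dominated vu ≤-refl a k))
  withinV-new-old-nearest S a k = trans (withinV-new-old S a k) (∨-absorbˡ (dominated vu (s≤s z≤n) a k))

  withinVE-new-oldE : ∀ x f k →
                      withinVE G k (new x) (oldE f) ≡ delay (depth x) (λ j → withinVE adj j (nearest x) f) k
  withinVE-new-oldE x (a , b) k =
    trans (cong₂ _∨_ (withinV-new-old-nearest x a k) (withinV-new-old-nearest x b k)) (delay-∨ (depth x) k)

  withinVE-new-crossU : ∀ x k → withinVE G k (new x) (old u , new P) ≡ atDist (crossU x) k
  withinVE-new-crossU x k =
    trans (cong₂ _∨_ (trans (withinV-new-old x u k) (throughEnds-u x k)) (withinV-new-new x P k))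
          (atDist-⊓ (toU x) (dn x P) k)

  withinVE-new-crossV : ∀ x k → withinVE G k (new x) (old v , new S) ≡ atDist (crossV x) k
  withinVE-new-crossV x k =
    trans (cong₂ _∨_ (trans (withinV-new-old x v k) (throughEnds-v x k)) (withinV-new-new x S k))
          (atDist-⊓ (toV x) (dn x S) k)

  withinVE-new-new : ∀ x a b k → withinVE G k (new x) (new a , new b) ≡ atDist (dn x a ⊓ dn x b) k
  withinVE-new-new x a b k =
    trans (cong₂ _∨_ (withinV-new-new x a k) (withinV-new-new x b k)) (atDist-⊓ (dn x a) (dn x b) k)

  countNew : (Edge (n + 4) → Bool) → ℕ
  countNew φ = ([ φ (old u , new P) ] + [ φ (old v , new S) ])
             + ([ φ (new P , new Q) ] + ([ φ (new Q , new R) ] + [ φ (new R , new S) ]))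

  count-edges-extend : ∀ φ → count φ (edges G) ≡ count (φ ∘ oldE) (edges adj) + countNew φ
  count-edges-extend φ = begin
    count φ (edges G)
      ≡⟨ count-edges G φ ⟩
    ∑[ x < n + 4 ] ∑[ y < n + 4 ] term x y
      ≡⟨ sum-↑ n _ ⟩
    ∑[ a < n ] ∑[ y < n + 4 ] term (old a) y + ∑[ i < 4 ] ∑[ y < n + 4 ] term (new i) y
      ≡⟨ cong₂ _+_ (sum-cong-≗ (λ a → sum-↑ n (term (old a))))
                   (sum-cong-≗ (λ i → sum-↑ n (term (new i)))) ⟩
    ∑[ a < n ] (∑[ b < n ] term (old a) (old b) + ∑[ j < 4 ] term (old a) (new j))
      + ∑[ i < 4 ] (∑[ b < n ] term (new i) (old b) + ∑[ j < 4 ] term (new i) (new j))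
      ≡⟨ cong₂ _+_ (∑-distrib-+ (λ a → ∑[ b < n ] term (old a) (old b)) (λ a → ∑[ j < 4 ] term (old a) (new j)))
                   (sum-cong-≗ (λ i → cong (_+ ∑[ j < 4 ] term (new i) (new j)) (sum-zero _ (new-old i)))) ⟩
    (∑[ a < n ] ∑[ b < n ] term (old a) (old b) + ∑[ a < n ] ∑[ j < 4 ] term (old a) (new j))
      + ∑[ i < 4 ] ∑[ j < 4 ] term (new i) (new j)
      ≡⟨ cong₂ _+_ (cong₂ _+_ old-old old-new) new-new ⟩
    (count (φ ∘ oldE) (edges adj) + ([ φ (old u , new P) ] + [ φ (old v , new S) ]))
      + ([ φ (new P , new Q) ] + ([ φ (new Q , new R) ] + [ φ (new R , new S) ]))
      ≡⟨ +-assoc (count (φ ∘ oldE) (edges adj)) _ _ ⟩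
    count (φ ∘ oldE) (edges adj) + countNew φ ∎
    where
    open ≡-Reasoning
    term : Fin (n + 4) → Fin (n + 4) → ℕ
    term x y = [ ((toℕ x <ᵇ toℕ y) ∧ G x y) ∧ φ (x , y) ]

    new-old : ∀ i b → term (new i) (old b) ≡ 0
    new-old i b rewrite toℕ-↑ʳ n i | toℕ-↑ˡ b 4
                      | ≤⇒<ᵇ≡false (≤-trans (n≤1+n (toℕ b)) (≤-trans (toℕ<n b) (m≤m+n n (toℕ i)))) = refl

    old-old : ∑[ a < n ] ∑[ b < n ] term (old a) (old b) ≡ count (φ ∘ oldE) (edges adj)
    old-old = trans (sum-cong-≗ (λ a → sum-cong-≗ (same a))) (sym (count-edges adj (φ ∘ oldE)))
      where
      same : ∀ a b → term (old a) (old b) ≡ [ ((toℕ a <ᵇ toℕ b) ∧ adj a b) ∧ φ (old a , old b) ]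
      same a b rewrite toℕ-↑ˡ a 4 | toℕ-↑ˡ b 4 | G-old-old a b = refl

    at-u at-v : Fin n → ℕ
    at-u a = [ (a == u) ∧ φ (old a , new P) ]
    at-v a = [ (a == v) ∧ φ (old a , new S) ]

    old-new : ∑[ a < n ] ∑[ j < 4 ] term (old a) (new j) ≡ [ φ (old u , new P) ] + [ φ (old v , new S) ]
    old-new = begin
      ∑[ a < n ] ∑[ j < 4 ] term (old a) (new j) ≡⟨ sum-cong-≗ cross ⟩
      ∑[ a < n ] (at-u a + at-v a)               ≡⟨ ∑-distrib-+ at-u at-v ⟩
      ∑[ a < n ] at-u a + ∑[ a < n ] at-v a      ≡⟨ cong₂ _+_ (sum-pickˡ u (λ a → φ (old a , new P)))
                                                              (sum-pickˡ v (λ a → φ (old a , new S))) ⟩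
      [ φ (old u , new P) ] + [ φ (old v , new S) ] ∎
      where
      term-cross : ∀ a j → term (old a) (new j) ≡ [ crossAdj u v a j ∧ φ (old a , new j) ]
      term-cross a j rewrite toℕ-↑ˡ a 4 | toℕ-↑ʳ n j | G-old-new a j
                           | <⇒<ᵇ≡true (<-≤-trans (toℕ<n a) (m≤m+n n (toℕ j))) = refl
      cross : ∀ a → ∑[ j < 4 ] term (old a) (new j) ≡ at-u a + at-v a
      cross a rewrite term-cross a P | term-cross a Q | term-cross a R | term-cross a S
                    | crossAdj-P a | crossAdj-Q a | crossAdj-S a | +-identityʳ (at-v a) = refl

    new-new : ∑[ i < 4 ] ∑[ j < 4 ] term (new i) (new j)
              ≡ [ φ (new P , new Q) ] + ([ φ (new Q , new R) ] + [ φ (new R , new S) ])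
    new-new = trans (sum-cong-≗ (λ i → sum-cong-≗ (path-term i)))
                    (drop-zeros [ φ (new P , new Q) ] [ φ (new Q , new R) ] [ φ (new R , new S) ])
      where
      drop-zeros : ∀ a b c → (a + 0) + ((b + 0) + ((c + 0) + 0)) ≡ a + (b + c)
      drop-zeros a b c rewrite +-identityʳ a | +-identityʳ b | +-identityʳ c | +-identityʳ c = refl

      path-term : ∀ i j → term (new i) (new j) ≡ [ ((toℕ i <ᵇ toℕ j) ∧ pathAdj i j) ∧ φ (new i , new j) ]
      path-term i j rewrite toℕ-↑ʳ n i | toℕ-↑ʳ n j | +-<ᵇ n (toℕ i) (toℕ j) | G-new-new i j = refl

  HeV-new : ∀ x k → HeV G (new x) k ≡ shift (depth x) (HeV adj (nearest x)) k + vertexProfile x k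
  HeV-new x k = trans (count-edges-extend φ) (cong₂ _+_ old-part new-part)
    where
    φ : Edge (n + 4) → Bool
    φ e = exactly (λ j → withinVE G j (new x) e) k

    old-part : count (φ ∘ oldE) (edges adj) ≡ shift (depth x) (HeV adj (nearest x)) k
    old-part = count-exactly-delay (depth x) _ (edges adj) k (withinVE-new-oldE x)

    new-part : countNew φ ≡ vertexProfile x k
    new-part = cong₂ _+_
      (cong₂ _+_ (exactly-≡atDist (crossU x) (withinVE-new-crossU x) k)
                 (exactly-≡atDist (crossV x) (withinVE-new-crossV x) k))
      (cong₂ _+_ (exactly-≡atDist (dn x P ⊓ dn x Q) (withinVE-new-new x P Q) k)
      (cong₂ _+_ (exactly-≡atDist (dn x Q ⊓ dn x R) (withinVE-new-new x Q R) k)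
                 (exactly-≡atDist (dn x R ⊓ dn x S) (withinVE-new-new x R S) k)))

  HeV-new-poly : ∀ x cs → (∀ k → vertexProfile x k ≡ poly cs k) →
                 ∀ k → HeV G (new x) k ≡ (shift (depth x) (HeV adj (nearest x)) ⊕ poly cs) k
  HeV-new-poly x cs profile k =
    trans (HeV-new x k) (cong (shift (depth x) (HeV adj (nearest x)) k +_) (profile k))

  =E-new-new : ∀ x y a b → ((new x , new y) =E (new a , new b)) ≡ ((x , y) =E (a , b))
  =E-new-new x y a b rewrite ==-new-new x a | ==-new-new y b | ==-new-new x b | ==-new-new y a = refl

  =E-new-old : ∀ x y a z → ((new x , new y) =E (old a , z)) ≡ false
  =E-new-old x y a z rewrite ==-new-old x a | ==-new-old y a = ∧-zeroʳ (new x == z)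

  withinE-path-edge : ∀ {x y} g → pathAdj x y ≡ true → ((new x , new y) =E g) ≡ false → ∀ d →
                      (∀ j → withinVE G j (new x) g ∨ withinVE G j (new y) g ≡ atDist d j) →
                      ∀ j → withinE G j (new x , new y) g ≡ atDist (suc d) j
  withinE-path-edge {x} {y} g x~y distinct d ends =
    atDist-suc-from d distinct (λ j → trans (Gᵉ.withinE-suc (trans (G-new-new x y) x~y) j g) (ends j))

  withinE-path-path : ∀ {x y} → pathAdj x y ≡ true → ∀ a b j →
                      withinE G j (new x , new y) (new a , new b) ≡ atDist (pathEdgeDist (x , y) (a , b)) j
  withinE-path-path {x} {y} x~y a b j with true⊎false ((x , y) =E (a , b))
  ... | inj₁ same rewrite same =
    Gᵉ.L.within-zero j {new x , new y} {new a , new b} (trans (=E-new-new x y a b) same)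
  ... | inj₂ distinct rewrite distinct =
    withinE-path-edge (new a , new b) x~y (trans (=E-new-new x y a b) distinct) _ ends j
    where
    ends : ∀ i → withinVE G i (new x) (new a , new b) ∨ withinVE G i (new y) (new a , new b)
                 ≡ atDist ((dn x a ⊓ dn x b) ⊓ (dn y a ⊓ dn y b)) i
    ends i = trans (cong₂ _∨_ (withinVE-new-new x a b i) (withinVE-new-new y a b i))
                   (atDist-⊓ (dn x a ⊓ dn x b) _ i)

  OldEndsNear : Fin 4 → Fin 4 → ℕ → (Edge n → ℕ → Bool) → Set
  OldEndsNear x y m Z =
    ∀ f j → withinVE G j (new x) (oldE f) ∨ withinVE G j (new y) (oldE f) ≡ delay m (Z f) j

  withinE-path-oldE : ∀ {x y} → pathAdj x y ≡ true → ∀ m Z → OldEndsNear x y m Z →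
                      ∀ f j → withinE G j (new x , new y) (oldE f) ≡ delay (suc m) (Z f) j
  withinE-path-oldE {x} {y} x~y m Z ends (a , b) zero    = =E-new-old x y a (old b)
  withinE-path-oldE {x} {y} x~y m Z ends (a , b) (suc j) =
    trans (Gᵉ.withinE-suc (trans (G-new-new x y) x~y) j (old a , old b)) (ends (a , b) j)

  HeE-path : ∀ x y → pathAdj x y ≡ true → ∀ m Z → OldEndsNear x y m Z → ∀ k →
             HeE G (new x , new y) k
               ≡ shift (suc m) (λ k → count (λ f → exactly (Z f) k) (edges adj)) k + edgeProfile x y k
  HeE-path x y x~y m Z ends k = trans (count-edges-extend φ) (cong₂ _+_ old-part new-part)
    where
    φ : Edge (n + 4) → Bool
    φ g = exactly (λ j → withinE G j (new x , new y) g) k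

    old-part : count (φ ∘ oldE) (edges adj) ≡ shift (suc m) (λ k → count (λ f → exactly (Z f) k) (edges adj)) k
    old-part = count-exactly-delay (suc m) Z (edges adj) k (withinE-path-oldE x~y m Z ends)

    cross : ∀ (c : Fin 4 → ℕ) a z → (∀ w j → withinVE G j (new w) (old a , z) ≡ atDist (c w) j) →
            [ φ (old a , z) ] ≡ [ suc (c x ⊓ c y) ≡ᵇ k ]
    cross c a z near = exactly-≡atDist (suc (c x ⊓ c y)) line k
      where
      line : ∀ j → withinE G j (new x , new y) (old a , z) ≡ atDist (suc (c x ⊓ c y)) j
      line = withinE-path-edge (old a , z) x~y (=E-new-old x y a z) (c x ⊓ c y)
                               (λ j → trans (cong₂ _∨_ (near x j) (near y j)) (atDist-⊓ (c x) (c y) j))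

    path : ∀ a b → [ φ (new a , new b) ] ≡ [ pathEdgeDist (x , y) (a , b) ≡ᵇ k ]
    path a b = exactly-≡atDist (pathEdgeDist (x , y) (a , b)) (withinE-path-path x~y a b) k

    new-part : countNew φ ≡ edgeProfile x y k
    new-part = cong₂ _+_
      (cong₂ _+_ (cross crossU u (new P) withinVE-new-crossU) (cross crossV v (new S) withinVE-new-crossV))
      (cong₂ _+_ (path P Q) (cong₂ _+_ (path Q R) (path R S)))

  HeE-PQ : ∀ k → HeE G (new P , new Q) k ≡ (shift 2 (HeV adj u) ⊕ poly (1 ∷ 2 ∷ 1 ∷ 1 ∷ [])) k
  HeE-PQ k = trans (HeE-path P Q refl 1 (λ f j → withinVE adj j u f) ends k)
                   (cong (shift 2 (HeV adj u) k +_) (edgeProfile-PQ k))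
    where
    ends : OldEndsNear P Q 1 (λ f j → withinVE adj j u f)
    ends f j = trans (cong₂ _∨_ (withinVE-new-oldE P f j) (withinVE-new-oldE Q f j))
                     (∨-absorbʳ (delay-≤ (s≤s z≤n) (G₀.withinVE-suc u f) j))

  HeE-RS : ∀ k → HeE G (new R , new S) k ≡ (shift 2 (HeV adj v) ⊕ poly (1 ∷ 2 ∷ 1 ∷ 1 ∷ [])) k
  HeE-RS k = trans (HeE-path R S refl 1 (λ f j → withinVE adj j v f) ends k)
                   (cong (shift 2 (HeV adj v) k +_) (edgeProfile-RS k))
    where
    ends : OldEndsNear R S 1 (λ f j → withinVE adj j v f)
    ends f j = trans (cong₂ _∨_ (withinVE-new-oldE R f j) (withinVE-new-oldE S f j))
                     (∨-absorbˡ (delay-≤ (s≤s z≤n) (G₀.withinVE-suc v f) j))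

  HeE-QR : ∀ k → HeE G (new Q , new R) k ≡ (shift 2 (HeE adj (u , v)) ⊕ poly (1 ∷ 2 ∷ 1 ∷ 1 ∷ [])) k
  HeE-QR k = trans (HeE-path Q R refl 2 (λ f j → G₀.endsWithin j u v f) ends k) (regroup k)
    where
    ends : OldEndsNear Q R 2 (λ f j → G₀.endsWithin j u v f)
    ends f j = trans (cong₂ _∨_ (withinVE-new-oldE Q f j) (withinVE-new-oldE R f j)) (delay-∨ 2 j)

    -- Edges counted by their distance to {u, v}; in the line graph of G₀ these distances grow by one,
    -- except for uv itself.
    countEnds : ℕ → ℕ
    countEnds k = count (λ f → exactly (λ j → G₀.endsWithin j u v f) k) (edges adj)

    regroup : ∀ k → shift 3 countEnds k + edgeProfile Q R k
                    ≡ (shift 2 (HeE adj (u , v)) ⊕ poly (1 ∷ 2 ∷ 1 ∷ 1 ∷ [])) k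
    regroup 0                         = refl
    regroup 1                         = refl
    regroup 2                         = sym (cong (_+ 1) (G₀.count-=E uv))
    regroup 3                         = trans (+-identityʳ _) (sym (G₀.HeE-one uv))
    regroup (suc (suc (suc (suc k)))) = cong (_+ 0) (sym (G₀.HeE-suc-suc uv k))

theorem3p2 : (n : ℕ) (adj : Adj n) → IsSimple adj → Connected adj →
    (u v : Fin n) → adj u v ≡ true →
    let G = extend adj u v in
    (∀ k → HeV G vp k ≡ (shift 1 (HeV adj u) ⊕ poly (2 ∷ 1 ∷ 2 ∷ [])) k) ×
    (∀ k → HeV G vq k ≡ (shift 2 (HeV adj u) ⊕ poly (2 ∷ 2 ∷ 1 ∷ [])) k) ×
    (∀ k → HeV G vr k ≡ (shift 2 (HeV adj v) ⊕ poly (2 ∷ 2 ∷ 1 ∷ [])) k) ×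
    (∀ k → HeV G vs k ≡ (shift 1 (HeV adj v) ⊕ poly (2 ∷ 1 ∷ 2 ∷ [])) k) ×
    (∀ k → HeE G (vp , vq) k ≡ (shift 2 (HeV adj u) ⊕ poly (1 ∷ 2 ∷ 1 ∷ 1 ∷ [])) k) ×
    (∀ k → HeE G (vq , vr) k ≡ (shift 2 (HeE adj (u , v)) ⊕ poly (1 ∷ 2 ∷ 1 ∷ 1 ∷ [])) k) ×
    (∀ k → HeE G (vr , vs) k ≡ (shift 2 (HeV adj v) ⊕ poly (1 ∷ 2 ∷ 1 ∷ 1 ∷ [])) k)
theorem3p2 n adj simple _ u v uv =
  HeV-new-poly P (2 ∷ 1 ∷ 2 ∷ []) vertexProfile-P ,
  HeV-new-poly Q (2 ∷ 2 ∷ 1 ∷ []) vertexProfile-Q ,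
  HeV-new-poly R (2 ∷ 2 ∷ 1 ∷ []) vertexProfile-R ,
  HeV-new-poly S (2 ∷ 1 ∷ 2 ∷ []) vertexProfile-S ,
  HeE-PQ , HeE-QR , HeE-RS
  where open Extension adj simple u v uv
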